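{- For every integer $m \ge 3$ there exist intersecting families $\mathcal{C}_1,\dots,\mathcal{C}_{m-2} \subseteq \mathcal{P}([m])$ such that, for every $I \subseteq [m]$, the number of indices $j$ with $I \in \mathcal{C}_j$ equals $0$ if $I = \emptyset$, equals $|I|-1$ if $I \ne \emptyset$ and $I \ne [m]$, and equals $m-2$ if $I = [m]$.
   Context: $[m] = \{1,\dots,m\}$ and $\mathcal{P}([m])$ is its power set. A family $\mathcal{C}$ of subsets is intersecting if every two (not necessarily distinct) members of $\mathcal{C}$ have non-empty intersection. -}

module Defs where

open import Data.Nat using (ℕ; _∸_)
open import Data.Bool using (Bool; true)
open import Data.Fin using (Fin)
open import Data.Fin.Subset using (Subset; _∩_; Nonempty)
open import Data.List using (length; filterᵇ; allFin)
open import Relation.Binary.PropositionalEquality using (_≡_)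

Family : ℕ → Set
Family m = Subset m → Bool

_∈ᶠ_ : ∀ {m} → Subset m → Family m → Set
I ∈ᶠ C = C I ≡ true

Intersecting : ∀ {m} → Family m → Set
Intersecting C = ∀ A B → A ∈ᶠ C → B ∈ᶠ C → Nonempty (A ∩ B)

countIn : ∀ {m k} → (Fin k → Family m) → Subset m → ℕ
countIn {k = k} C I = length (filterᵇ (λ j → C j I) (allFin k))

module Submission where

-- Write m = k + 2 and identify [m] with Fin (k + 2).  For each pivot j < k
-- the family C_j consists of the sets I such that
--   * j ∈ I and I meets the tail {j+1, …, m-1}, or
--   * j ∉ I and I contains the whole tail {j+1, …, m-1}.
-- Any two members meet: at j, or inside the tail, which is non-empty.
--
-- Stripping the first coordinate of I = x ∷ I' turns C_{j+1} into C_j on I',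
-- so the number of families containing I obeys
--   count_{k+1} (x ∷ I') = [x ∷ I' ∈ C_0] + count_k I'.
-- By induction on k this yields one invariant covering all three cases:
--   count_k I + [I = ⊤] = |I| ∸ 1                       (count-invariant).

open import Defs
open import Data.Nat using (ℕ; zero; suc; _+_; _∸_; _≤_; s≤s)
open import Data.Nat.Properties using (+-assoc; +-comm; +-identityʳ; suc-injective)
open import Data.Bool using (Bool; true; false)
open import Data.Empty using () renaming (⊥-elim to contradiction)
open import Data.Fin using (Fin; zero; suc)
open import Data.Fin.Subset using (Subset; ⊥; ⊤; ∣_∣; _∩_; Nonempty)
open import Data.Fin.Subset.Properties using (∈⊤; ∣⊤∣≡n; ∣⊥∣≡0; x∈p∩q⁺)
open import Data.Vec using ([]; _∷_; here; there)
open import Data.List using (length; filterᵇ; allFin; tabulate)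
open import Data.Product using (Σ; _×_; _,_)
open import Function using (_∘_)
open import Relation.Binary.PropositionalEquality
  using (_≡_; _≢_; refl; cong; sym; trans; module ≡-Reasoning)
open import Relation.Nullary using (¬_)

bit : Bool → ℕ
bit true  = 1
bit false = 0

isNonempty : ∀ {n} → Subset n → Bool
isNonempty []          = false
isNonempty (true  ∷ _) = true
isNonempty (false ∷ I) = isNonempty I

isFull : ∀ {n} → Subset n → Bool
isFull []          = true
isFull (false ∷ _) = false
isFull (true  ∷ I) = isFull I

isNonempty-sound : ∀ {n} (I : Subset n) → isNonempty I ≡ true → Nonempty I
isNonempty-sound (true  ∷ I) _ = zero , here
isNonempty-sound (false ∷ I) e with isNonempty-sound I e
... | i , i∈I = suc i , there i∈I

isFull-sound : ∀ {n} (I : Subset n) → isFull I ≡ true → I ≡ ⊤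
isFull-sound []         _ = refl
isFull-sound (true ∷ I) e = cong (true ∷_) (isFull-sound I e)

isFull-⊤ : ∀ n → isFull (⊤ {n}) ≡ true
isFull-⊤ zero    = refl
isFull-⊤ (suc n) = isFull-⊤ n

isFull-complete : ∀ {n} (I : Subset n) → I ≢ ⊤ → isFull I ≡ false
isFull-complete I I≢⊤ with isFull I in full
... | true  = contradiction (I≢⊤ (isFull-sound I full))
... | false = refl

card-split : ∀ {n} (I : Subset n) → ∣ I ∣ ≡ bit (isNonempty I) + (∣ I ∣ ∸ 1)
card-split []          = refl
card-split (true  ∷ I) = refl
card-split (false ∷ I) = card-split I

pivotFamily : ∀ {n} → Family (suc n)
pivotFamily (true  ∷ I) = isNonempty I
pivotFamily (false ∷ I) = isFull I

family : ∀ k → Fin k → Family (suc (suc k))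
family (suc k) zero           = pivotFamily
family (suc k) (suc j) (x ∷ I) = family k j I

pivotFamily-intersecting : ∀ {n} → Intersecting (pivotFamily {suc n})
pivotFamily-intersecting (true ∷ A) (true ∷ B) _ _ = zero , here
pivotFamily-intersecting (true ∷ A) (false ∷ B) a b
  with isNonempty-sound A a | isFull-sound B b
... | i , i∈A | refl = suc i , there (x∈p∩q⁺ (i∈A , ∈⊤))
pivotFamily-intersecting (false ∷ A) (true ∷ B) a b
  with isFull-sound A a | isNonempty-sound B b
... | refl | i , i∈B = suc i , there (x∈p∩q⁺ (∈⊤ , i∈B))
pivotFamily-intersecting (false ∷ A) (false ∷ B) a b
  with isFull-sound A a | isFull-sound B b
... | refl | refl = suc zero , there (x∈p∩q⁺ (∈⊤ , ∈⊤))

∷-meet : ∀ {n} x y {A B : Subset n} →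
         Nonempty (A ∩ B) → Nonempty ((x ∷ A) ∩ (y ∷ B))
∷-meet x y (i , i∈A∩B) = suc i , there i∈A∩B

family-intersecting : ∀ k (j : Fin k) → Intersecting (family k j)
family-intersecting (suc k) zero = pivotFamily-intersecting
family-intersecting (suc k) (suc j) (x ∷ A) (y ∷ B) a b =
  ∷-meet x y (family-intersecting k j A B a b)

filter-tabulate : ∀ {A : Set} {n} (p : A → Bool) (f : Fin n → A) →
  length (filterᵇ p (tabulate f)) ≡ length (filterᵇ (p ∘ f) (allFin n))
filter-tabulate {n = zero}  p f = refl
filter-tabulate {n = suc n} p f with p (f zero)
... | true  = cong suc (trans (filter-tabulate p (f ∘ suc)) (sym (filter-tabulate (p ∘ f) suc)))
... | false = trans (filter-tabulate p (f ∘ suc)) (sym (filter-tabulate (p ∘ f) suc))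

countIn-suc : ∀ {m k} (C : Fin (suc k) → Family m) (I : Subset m) →
  countIn C I ≡ bit (C zero I) + countIn (C ∘ suc) I
countIn-suc C I with C zero I
... | true  = cong suc (filter-tabulate (λ j → C j I) suc)
... | false = filter-tabulate (λ j → C j I) suc

count-invariant : ∀ k (I : Subset (suc (suc k))) →
  countIn (family k) I + bit (isFull I) ≡ ∣ I ∣ ∸ 1
count-invariant zero (true  ∷ true  ∷ []) = refl
count-invariant zero (true  ∷ false ∷ []) = refl
count-invariant zero (false ∷ true  ∷ []) = refl
count-invariant zero (false ∷ false ∷ []) = refl
count-invariant (suc k) (true ∷ I) = begin
  countIn (family (suc k)) (true ∷ I) + bit (isFull I)
    ≡⟨ cong (_+ bit (isFull I)) (countIn-suc (family (suc k)) (true ∷ I)) ⟩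
  bit (isNonempty I) + countIn (family k) I + bit (isFull I)
    ≡⟨ +-assoc (bit (isNonempty I)) _ _ ⟩
  bit (isNonempty I) + (countIn (family k) I + bit (isFull I))
    ≡⟨ cong (bit (isNonempty I) +_) (count-invariant k I) ⟩
  bit (isNonempty I) + (∣ I ∣ ∸ 1)
    ≡⟨ sym (card-split I) ⟩
  ∣ I ∣ ∎
  where open ≡-Reasoning
count-invariant (suc k) (false ∷ I) = begin
  countIn (family (suc k)) (false ∷ I) + 0
    ≡⟨ +-identityʳ _ ⟩
  countIn (family (suc k)) (false ∷ I)
    ≡⟨ countIn-suc (family (suc k)) (false ∷ I) ⟩
  bit (isFull I) + countIn (family k) I
    ≡⟨ +-comm (bit (isFull I)) _ ⟩
  countIn (family k) I + bit (isFull I)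
    ≡⟨ count-invariant k I ⟩
  ∣ I ∣ ∸ 1 ∎
  where open ≡-Reasoning

count-⊥ : ∀ k → countIn (family k) ⊥ ≡ 0
count-⊥ k = begin
  countIn (family k) empty     ≡⟨ sym (+-identityʳ _) ⟩
  countIn (family k) empty + 0 ≡⟨ count-invariant k empty ⟩
  ∣ empty ∣ ∸ 1                ≡⟨ cong (_∸ 1) (∣⊥∣≡0 (suc (suc k))) ⟩
  0                            ∎
  where
  open ≡-Reasoning
  empty : Subset (suc (suc k))
  empty = ⊥

count-⊤ : ∀ k → countIn (family k) ⊤ ≡ k
count-⊤ k = suc-injective (begin
  suc (countIn (family k) full)
    ≡⟨ +-comm 1 _ ⟩
  countIn (family k) full + 1
    ≡⟨ cong (λ b → countIn (family k) full + bit b) (sym (isFull-⊤ (suc (suc k)))) ⟩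
  countIn (family k) full + bit (isFull full)
    ≡⟨ count-invariant k full ⟩
  ∣ full ∣ ∸ 1
    ≡⟨ cong (_∸ 1) (∣⊤∣≡n (suc (suc k))) ⟩
  suc k ∎)
  where
  open ≡-Reasoning
  full : Subset (suc (suc k))
  full = ⊤

count-proper : ∀ k (I : Subset (suc (suc k))) → I ≢ ⊤ →
  countIn (family k) I ≡ ∣ I ∣ ∸ 1
count-proper k I I≢⊤ = begin
  countIn (family k) I
    ≡⟨ sym (+-identityʳ _) ⟩
  countIn (family k) I + 0
    ≡⟨ cong (λ b → countIn (family k) I + bit b) (sym (isFull-complete I I≢⊤)) ⟩
  countIn (family k) I + bit (isFull I)
    ≡⟨ count-invariant k I ⟩
  ∣ I ∣ ∸ 1 ∎
  where open ≡-Reasoning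

lemma3p10 : (m : ℕ) → 3 ≤ m →
    Σ (Fin (m ∸ 2) → Family m) λ C →
      ((j : Fin (m ∸ 2)) → Intersecting (C j)) ×
      ((I : Subset m) →
        (I ≡ ⊥ → countIn C I ≡ 0) ×
        (¬ I ≡ ⊥ → ¬ I ≡ ⊤ → countIn C I ≡ ∣ I ∣ ∸ 1) ×
        (I ≡ ⊤ → countIn C I ≡ m ∸ 2))
lemma3p10 (suc (suc k)) _ = family k , family-intersecting k , λ I →
  (λ { refl → count-⊥ k }) ,
  (λ _ I≢⊤ → count-proper k I I≢⊤) ,
  (λ { refl → count-⊤ k })
lemma3p10 (suc zero) (s≤s ())
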